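{- Let $R$ be a commutative ring with identity, and let $I$ and $J$ be non-trivial ideals of $R$ having primary decompositions $I=\bigcap_i Q_i$ and $J=\bigcap_j Q'_j$. If $\operatorname{Max}(R)\not\subseteq \operatorname{Ass}(I)\cup\operatorname{Ass}(J)$, then the distance between $I$ and $J$ in $\Gamma_0(R)$ satisfies $d(I,J)\le 2$.
   Context: $\Gamma_0(R)$ is the simple graph whose vertices are the non-trivial ideals of $R$ (ideals other than $0$ and $R$), two distinct ideals being adjacent iff $IJ=I\cap J$. An ideal $Q\ne R$ is primary if $xy\in Q$ implies $x\in Q$ or $y\in r(Q)$ ($r(Q)$ the radical). For a primary decomposition $I=\bigcap_i Q_i$, $\operatorname{Ass}(I)=\{r(Q_i)\}$ (and similarly for $J$). $\operatorname{Max}(R)$ is the set of maximal ideals of $R$. -}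

module Defs where

open import Level using (Level; _⊔_; suc)
open import Algebra.Bundles using (CommutativeRing)
open import Data.Nat using (ℕ; zero) renaming (suc to sucℕ)
open import Data.List using (List; []; _∷_)
open import Data.List.Relation.Unary.All using (All)
open import Data.List.Relation.Unary.Any using (Any)
open import Data.Product using (Σ; _×_; _,_)
open import Data.Sum using (_⊎_)
open import Relation.Nullary using (¬_)
open import Data.Unit using (⊤)
open import Level using (Lift)

module _ {c ℓ : Level} (R : CommutativeRing c ℓ) where
  open CommutativeRing R

  pow : Carrier → ℕ → Carrier
  pow x zero = 1#
  pow x (sucℕ n) = x * pow x n

  Subset : Set (c ⊔ suc (c ⊔ ℓ))
  Subset = Carrier → Set (c ⊔ ℓ)

  _⊆ₛ_ : Subset → Subset → Set (c ⊔ ℓ)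
  A ⊆ₛ B = ∀ x → A x → B x

  _≐ₛ_ : Subset → Subset → Set (c ⊔ ℓ)
  A ≐ₛ B = (A ⊆ₛ B) × (B ⊆ₛ A)

  record Ideal : Set (suc (c ⊔ ℓ)) where
    field
      mem    : Subset
      resp   : ∀ {x y} → x ≈ y → mem x → mem y
      0∈     : mem 0#
      +-clos : ∀ {x y} → mem x → mem y → mem (x + y)
      *-clos : ∀ r {x} → mem x → mem (r * x)
  open Ideal public

  _≐_ : Ideal → Ideal → Set (c ⊔ ℓ)
  I ≐ J = mem I ≐ₛ mem J

  IsUnit : Ideal → Set (c ⊔ ℓ)
  IsUnit I = mem I 1#

  IsZero : Ideal → Set (c ⊔ ℓ)
  IsZero I = ∀ x → mem I x → x ≈ 0#

  NonTrivial : Ideal → Set (c ⊔ ℓ)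
  NonTrivial I = ¬ IsZero I × ¬ IsUnit I

  sumProd : List (Carrier × Carrier) → Carrier
  sumProd [] = 0#
  sumProd ((a , b) ∷ ps) = a * b + sumProd ps

  prodMem : Ideal → Ideal → Subset
  prodMem I J x = Σ (List (Carrier × Carrier)) λ ps →
    All (λ { (a , b) → mem I a × mem J b }) ps × x ≈ sumProd ps

  interMem : Ideal → Ideal → Subset
  interMem I J x = mem I x × mem J x

  radMem : Ideal → Subset
  radMem Q x = Σ ℕ λ n → mem Q (pow x n)

  IsPrimary : Ideal → Set (c ⊔ ℓ)
  IsPrimary Q = ¬ IsUnit Q × (∀ x y → mem Q (x * y) → mem Q x ⊎ radMem Q y)

  IsMaximal : Ideal → Set (suc (c ⊔ ℓ))
  IsMaximal M = ¬ IsUnit M × (∀ (N : Ideal) → mem M ⊆ₛ mem N → (N ≐ M) ⊎ IsUnit N)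

  bigInterMem : List Ideal → Subset
  bigInterMem [] x = Lift (c ⊔ ℓ) ⊤
  bigInterMem (Q ∷ Qs) x = mem Q x × bigInterMem Qs x

  IsPrimaryDecomposition : Ideal → List Ideal → Set (suc (c ⊔ ℓ))
  IsPrimaryDecomposition I Qs =
    All IsPrimary Qs × (mem I ≐ₛ bigInterMem Qs)

  -- P ∈ Ass(I) = { r(Q) | Q ∈ Qs }, relative to the decomposition Qs
  InAss : List Ideal → Ideal → Set (suc (c ⊔ ℓ))
  InAss Qs P = Any (λ Q → radMem Q ≐ₛ mem P) Qs

  -- the graph Γ₀(R): vertices are non-trivial ideals (up to set equality)
  Adjacent : Ideal → Ideal → Set (c ⊔ ℓ)
  Adjacent I J = ¬ (I ≐ J) × (prodMem I J ≐ₛ interMem I J)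

  DistLe2 : Ideal → Ideal → Set (suc (c ⊔ ℓ))
  DistLe2 I J = (I ≐ J) ⊎ Adjacent I J ⊎
    Σ Ideal (λ K → NonTrivial K × Adjacent I K × Adjacent K J)

module Submission where

-- If a maximal ideal M is not an associated prime of I or of J, then prime
-- avoidance yields x ∈ M outside every radical r(Q) of the primary components
-- of I and of J.  Such an x is regular modulo I and modulo J (r·x ∈ I ⇒ r ∈ I),
-- and for a regular x ∉ I one has I ∩ (x) = I·(x).  Hence the principal ideal
-- K = (x), which is non-trivial (x ∈ M, x ∉ I), is adjacent to both I and J,
-- giving the path I — K — J in Γ₀(R).

open import Defs
open import Level using (Level; _⊔_; suc; lift; lower)
open import Algebra.Bundles using (CommutativeRing)
open import Data.Nat using (zero) renaming (suc to sucℕ; _+_ to _+ℕ_; _*_ to _*ℕ_)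
open import Data.Nat.Properties using (+-suc)
open import Data.List using (List; []; _∷_; _++_; map)
open import Data.List.Relation.Unary.All using (All; []; _∷_; zipWith) renaming (map to mapAll)
import Data.List.Relation.Unary.All.Properties as AllP
import Data.List.Relation.Unary.Any.Properties as AnyP
open import Data.Sum using (_⊎_; inj₁; inj₂; fromInj₁; [_,_]′; map₂)
open import Data.Product using (Σ; _×_; _,_; proj₁; proj₂; swap)
open import Data.Empty using (⊥-elim)
open import Data.Unit using (tt)
open import Function using (_∘_)
open import Relation.Nullary using (¬_; yes; no)
open import Relation.Nullary.Decidable using (map′)
open import Relation.Binary.PropositionalEquality as ≡ using (_≡_)
open import Axiom.ExcludedMiddle using (ExcludedMiddle)
open import Axiom.DoubleNegationElimination using (DoubleNegationElimination; em⇒dne)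

module _ {c ℓ : Level} (R : CommutativeRing c ℓ) where
  open CommutativeRing R hiding (zero)
  open import Algebra.Properties.Semiring.Exp semiring using (_^_; ^-congˡ; ^-assocʳ)
  open import Algebra.Properties.CommutativeSemiring.Exp commutativeSemiring using (^-distrib-*)
  open import Algebra.Properties.Ring ring using (-1*x≈-x)
  open import Algebra.Properties.Group +-group using (//-rightDividesʳ)
  open import Relation.Binary.Reasoning.Setoid setoid

  pow≡^ : ∀ x n → pow R x n ≡ x ^ n
  pow≡^ x zero = ≡.refl
  pow≡^ x (sucℕ n) = ≡.cong (x *_) (pow≡^ x n)

  pow-cong : ∀ {x y} n → x ≈ y → pow R x n ≈ pow R y n
  pow-cong {x} {y} n x≈y rewrite pow≡^ x n | pow≡^ y n = ^-congˡ n x≈y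

  pow-* : ∀ x y n → pow R (x * y) n ≈ pow R x n * pow R y n
  pow-* x y n rewrite pow≡^ (x * y) n | pow≡^ x n | pow≡^ y n = ^-distrib-* x y n

  pow-pow : ∀ x m n → pow R (pow R x m) n ≈ pow R x (m *ℕ n)
  pow-pow x m n rewrite pow≡^ x m | pow≡^ (x ^ m) n | pow≡^ x (m *ℕ n) = ^-assocʳ x m n

  pow-1 : ∀ n → pow R 1# n ≈ 1#
  pow-1 zero = refl
  pow-1 (sucℕ n) = trans (*-identityˡ _) (pow-1 n)

  ideal-cancelʳ : (I : Ideal R) → ∀ {x z} → mem I (x + z) → mem I z → mem I x
  ideal-cancelʳ I {x} {z} x+z∈I z∈I =
    resp I (//-rightDividesʳ z x) (+-clos I x+z∈I (resp I (-1*x≈-x z) (*-clos I (- 1#) z∈I)))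

  ideal-cancelˡ : (I : Ideal R) → ∀ {x z} → mem I (x + z) → mem I x → mem I z
  ideal-cancelˡ I {x} {z} x+z∈I = ideal-cancelʳ I (resp I (+-comm x z) x+z∈I)

  rotate : ∀ t cf y → t * (cf * y) ≈ (cf * t) * y
  rotate t cf y = trans (sym (*-assoc t cf y)) (*-congʳ (*-comm t cf))

  module _ (Q : Ideal R) where
    rad-resp : ∀ {x y} → x ≈ y → radMem R Q x → radMem R Q y
    rad-resp x≈y (n , xⁿ∈Q) = n , resp Q (pow-cong n x≈y) xⁿ∈Q

    rad-0 : radMem R Q 0#
    rad-0 = 1 , resp Q (sym (zeroˡ 1#)) (0∈ Q)

    rad-* : ∀ r {x} → radMem R Q x → radMem R Q (r * x)
    rad-* r {x} (n , xⁿ∈Q) = n , resp Q (sym (pow-* r x n)) (*-clos Q (pow R r n) xⁿ∈Q)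

    absorb : ∀ {cf y} → mem Q (cf * 1#) → mem Q (cf * y)
    absorb {cf} {y} cf∈Q = resp Q (*-comm y cf) (*-clos Q y (resp Q (*-identityʳ cf) cf∈Q))

    -- The binomial step behind closure of r(Q) under addition, by induction
    -- on (u , v): if c·aᵘ, c·bᵛ ∈ Q then c·(a + b)ᵘ⁺ᵛ ∈ Q.
    scaled-power-sum : ∀ a b u v cf → mem Q (cf * pow R a u) → mem Q (cf * pow R b v) →
                       mem Q (cf * pow R (a + b) (u +ℕ v))
    scaled-power-sum a b zero v cf cf∈Q _ = absorb cf∈Q
    scaled-power-sum a b (sucℕ u) zero cf _ cf∈Q = absorb cf∈Q
    scaled-power-sum a b (sucℕ u) (sucℕ v) cf cfaᵘ⁺¹ cfbᵛ⁺¹ = resp Q expand (+-clos Q via-a via-b)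
      where
      S : Carrier
      S = pow R (a + b) (u +ℕ sucℕ v)
      via-a : mem Q ((cf * a) * S)
      via-a = scaled-power-sum a b u (sucℕ v) (cf * a)
                (resp Q (sym (*-assoc cf a _)) cfaᵘ⁺¹) (resp Q (rotate a cf _) (*-clos Q a cfbᵛ⁺¹))
      -- stated with u + (1 + v) spelled out, as it is rewritten to 1 + (u + v)
      via-b : mem Q ((cf * b) * pow R (a + b) (u +ℕ sucℕ v))
      via-b rewrite +-suc u v = scaled-power-sum a b (sucℕ u) v (cf * b)
                (resp Q (rotate b cf _) (*-clos Q b cfaᵘ⁺¹)) (resp Q (sym (*-assoc cf b _)) cfbᵛ⁺¹)
      expand : (cf * a) * S + (cf * b) * S ≈ cf * ((a + b) * S)
      expand = begin
        (cf * a) * S + (cf * b) * S ≈⟨ distribʳ S (cf * a) (cf * b) ⟨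
        (cf * a + cf * b) * S       ≈⟨ *-congʳ (distribˡ cf a b) ⟨
        (cf * (a + b)) * S          ≈⟨ *-assoc cf (a + b) S ⟩
        cf * ((a + b) * S)          ∎

    rad-+ : ∀ {x y} → radMem R Q x → radMem R Q y → radMem R Q (x + y)
    rad-+ {x} {y} (n , xⁿ∈Q) (k , yᵏ∈Q) = n +ℕ k ,
      resp Q (*-identityˡ _) (scaled-power-sum x y n k 1#
        (resp Q (sym (*-identityˡ _)) xⁿ∈Q) (resp Q (sym (*-identityˡ _)) yᵏ∈Q))

  radical : Ideal R → Ideal R
  radical Q = record
    { mem = radMem R Q ; resp = rad-resp Q ; 0∈ = rad-0 Q ; +-clos = rad-+ Q ; *-clos = rad-* Q }

  IsPrime : Ideal R → Set (c ⊔ ℓ)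
  IsPrime P = ¬ IsUnit R P × (∀ a b → mem P (a * b) → mem P a ⊎ mem P b)

  radical-prime : ∀ {Q} → IsPrimary R Q → IsPrime (radical Q)
  radical-prime {Q} (Q≠R , primary) = 1∉rQ , split
    where
    1∉rQ : ¬ radMem R Q 1#
    1∉rQ (n , 1ⁿ∈Q) = Q≠R (resp Q (pow-1 n) 1ⁿ∈Q)
    split : ∀ a b → radMem R Q (a * b) → radMem R Q a ⊎ radMem R Q b
    split a b (n , abⁿ∈Q) with primary (pow R a n) (pow R b n) (resp Q (pow-* a b n) abⁿ∈Q)
    ... | inj₁ aⁿ∈Q = inj₁ (n , aⁿ∈Q)
    ... | inj₂ (m , bⁿᵐ∈Q) = inj₂ (n *ℕ m , resp Q (pow-pow b n m) bⁿᵐ∈Q)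

  product⊆left : (I J : Ideal R) → _⊆ₛ_ R (prodMem R I J) (mem I)
  product⊆left I J x (ps , factors , x≈) = resp I (sym x≈) (sum∈I ps factors)
    where
    sum∈I : ∀ ps → All (λ { (a , b) → mem I a × mem J b }) ps → mem I (sumProd R ps)
    sum∈I [] [] = 0∈ I
    sum∈I ((a , b) ∷ ps) ((a∈I , _) ∷ factors) =
      +-clos I (resp I (*-comm b a) (*-clos I b a∈I)) (sum∈I ps factors)

  sumProd-swap : ∀ ps → sumProd R ps ≈ sumProd R (map swap ps)
  sumProd-swap [] = refl
  sumProd-swap ((a , b) ∷ ps) = +-cong (*-comm a b) (sumProd-swap ps)

  product-comm : (I J : Ideal R) → _⊆ₛ_ R (prodMem R I J) (prodMem R J I)
  product-comm I J x (ps , factors , x≈) =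
    map swap ps , AllP.map⁺ (mapAll swap factors) , trans x≈ (sumProd-swap ps)

  -- IJ ⊆ I ∩ J always holds; adjacency is about the reverse inclusion.
  product⊆intersection : (I J : Ideal R) → _⊆ₛ_ R (prodMem R I J) (interMem R I J)
  product⊆intersection I J x x∈IJ =
    product⊆left I J x x∈IJ , product⊆left J I x (product-comm I J x x∈IJ)

  adjacent-sym : (I J : Ideal R) → Adjacent R I J → Adjacent R J I
  adjacent-sym I J (I≠J , _ , ∩⊆prod) =
    (I≠J ∘ swap) , product⊆intersection J I ,
    λ x x∈J∩I → product-comm I J x (∩⊆prod x (swap x∈J∩I))

  principal : Carrier → Ideal R
  principal x = record
    { mem = λ a → Σ Carrier λ r → a ≈ r * x
    ; resp = λ { a≈b (r , a≈rx) → r , trans (sym a≈b) a≈rx }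
    ; 0∈ = 0# , sym (zeroˡ x)
    ; +-clos = λ { (r , a≈rx) (s , b≈sx) → r + s , trans (+-cong a≈rx b≈sx) (sym (distribʳ x r s)) }
    ; *-clos = λ { t (r , a≈rx) → t * r , trans (*-congˡ a≈rx) (sym (*-assoc t r x)) }
    }

  x∈⟨x⟩ : ∀ x → mem (principal x) x
  x∈⟨x⟩ x = 1# , sym (*-identityˡ x)

  principal-nontrivial : ∀ {x} (I M : Ideal R) → ¬ mem I x → mem M x → ¬ IsUnit R M →
                         NonTrivial R (principal x)
  principal-nontrivial {x} I M x∉I x∈M M≠R =
    (λ ⟨x⟩=0 → x∉I (resp I (sym (⟨x⟩=0 x (x∈⟨x⟩ x))) (0∈ I))) ,
    (λ { (r , 1≈rx) → M≠R (resp M (sym 1≈rx) (*-clos M r x∈M)) })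

  Regular : Ideal R → Carrier → Set (c ⊔ ℓ)
  Regular I x = ∀ r → mem I (r * x) → mem I r

  regular-∉ : ∀ (I : Ideal R) {x} → ¬ IsUnit R I → Regular I x → ¬ mem I x
  regular-∉ I {x} I≠R reg x∈I = I≠R (reg 1# (resp I (sym (*-identityˡ x)) x∈I))

  adjacent-principal : ∀ (I : Ideal R) {x} → ¬ IsUnit R I → Regular I x → Adjacent R I (principal x)
  adjacent-principal I {x} I≠R reg =
    (λ I=⟨x⟩ → regular-∉ I I≠R reg (proj₂ I=⟨x⟩ x (x∈⟨x⟩ x))) ,
    product⊆intersection I (principal x) ,
    λ { a (a∈I , (r , a≈rx)) →
          ((r , x) ∷ []) , (reg r (resp I a≈rx a∈I) , x∈⟨x⟩ x) ∷ [] , trans a≈rx (sym (+-identityʳ _)) }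

  primary-regular : ∀ {Q x} → IsPrimary R Q → ¬ radMem R Q x → Regular Q x
  primary-regular {x = x} (_ , primary) x∉rQ r rx∈Q = fromInj₁ (⊥-elim ∘ x∉rQ) (primary r x rx∈Q)

  regular-⋂ : ∀ {x} Qs → All (λ Q → Regular Q x) Qs →
              ∀ r → bigInterMem R Qs (r * x) → bigInterMem R Qs r
  regular-⋂ [] [] r _ = lift tt
  regular-⋂ (Q ∷ Qs) (reg ∷ regs) r (rx∈Q , rx∈⋂) = reg r rx∈Q , regular-⋂ Qs regs r rx∈⋂

  regular-decomposition : ∀ (I : Ideal R) Qs {x} → IsPrimaryDecomposition R I Qs →
                          All (λ Q → ¬ radMem R Q x) Qs → Regular I x
  regular-decomposition I Qs {x} (primaries , I⊆⋂ , ⋂⊆I) avoids r rx∈I =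
    ⋂⊆I r (regular-⋂ Qs regulars r (I⊆⋂ _ rx∈I))
    where
    regulars : All (λ Q → Regular Q x) Qs
    regulars = zipWith (λ {Q} (primQ , x∉rQ) → primary-regular {Q} primQ x∉rQ) (primaries , avoids)

  maximal-not-below-radical : ∀ {Q M} → IsPrimary R Q → IsMaximal R M →
                              ¬ (_≐ₛ_ R (radMem R Q) (mem M)) → ¬ (_⊆ₛ_ R (mem M) (radMem R Q))
  maximal-not-below-radical {Q} primQ (_ , maximal) rQ≠M M⊆rQ =
    [ rQ≠M , proj₁ (radical-prime {Q} primQ) ]′ (maximal (radical Q) M⊆rQ)

  module _ (em : ExcludedMiddle (suc (c ⊔ ℓ))) where
    dne : DoubleNegationElimination (suc (c ⊔ ℓ))
    dne = em⇒dne em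

    em′ : ExcludedMiddle (c ⊔ ℓ)
    em′ = map′ lower lift em

    dne′ : DoubleNegationElimination (c ⊔ ℓ)
    dne′ = em⇒dne em′

    ¬∀⇒∃¬ : ∀ {A : Set (suc (c ⊔ ℓ))} {P Q : A → Set (suc (c ⊔ ℓ))} →
            ¬ (∀ a → P a → Q a) → Σ A λ a → P a × ¬ Q a
    ¬∀⇒∃¬ ¬∀ = dne λ ¬∃ → ¬∀ λ a Pa → dne λ ¬Qa → ¬∃ (a , Pa , ¬Qa)

    subset-or-witness : (A B : Subset R) → _⊆ₛ_ R A B ⊎ Σ Carrier (λ x → A x × ¬ B x)
    subset-or-witness A B with em′ {Σ Carrier (λ x → A x × ¬ B x)}
    ... | yes witness = inj₂ witness
    ... | no ¬witness = inj₁ λ x x∈A → dne′ λ x∉B → ¬witness (x , x∈A , x∉B)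

    module _ (M : Ideal R) where
      -- Given y ∈ M outside the prime P₀, find z ∈ M outside P₀ lying in every
      -- P ∈ Ps not contained in P₀ (multiply y by witnesses of P ⊄ P₀).
      separate : ∀ {P₀} → IsPrime P₀ → ∀ {y} → mem M y → ¬ mem P₀ y → (Ps : List (Ideal R)) →
                 Σ Carrier λ z → mem M z × ¬ mem P₀ z ×
                   All (λ P → _⊆ₛ_ R (mem P) (mem P₀) ⊎ mem P z) Ps
      separate _ y∈M y∉P₀ [] = _ , y∈M , y∉P₀ , []
      separate {P₀} primeP₀ y∈M y∉P₀ (P ∷ Ps)
        with separate {P₀} primeP₀ y∈M y∉P₀ Ps | subset-or-witness (mem P) (mem P₀)
      ... | z , z∈M , z∉P₀ , zs | inj₁ P⊆P₀ = z , z∈M , z∉P₀ , inj₁ P⊆P₀ ∷ zs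
      ... | z , z∈M , z∉P₀ , zs | inj₂ (p , p∈P , p∉P₀) =
        p * z , *-clos M p z∈M , [ p∉P₀ , z∉P₀ ]′ ∘ proj₂ primeP₀ p z ,
        inj₂ (resp P (*-comm z p) (*-clos P z p∈P)) ∷ mapAll (λ {Q} → map₂ (*-clos Q p)) zs

      prime-avoidance : (Ps : List (Ideal R)) → All IsPrime Ps →
                        All (λ P → ¬ (_⊆ₛ_ R (mem M) (mem P))) Ps →
                        Σ Carrier λ x → mem M x × All (λ P → ¬ mem P x) Ps
      prime-avoidance [] [] [] = 0# , 0∈ M , []
      prime-avoidance (P₀ ∷ Ps) (primeP₀ ∷ primes) (M⊈P₀ ∷ M⊈Ps)
        with prime-avoidance Ps primes M⊈Ps
      ... | x , x∈M , x∉Ps with em′ {mem P₀ x}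
      ...   | no x∉P₀ = x , x∈M , x∉P₀ ∷ x∉Ps
      ...   | yes x∈P₀ with subset-or-witness (mem M) (mem P₀)
      ...     | inj₁ M⊆P₀ = ⊥-elim (M⊈P₀ M⊆P₀)
      ...     | inj₂ (y , y∈M , y∉P₀) with separate {P₀} primeP₀ y∈M y∉P₀ Ps
      ...       | z , z∈M , z∉P₀ , zs =
        x + z , +-clos M x∈M z∈M , sum∉P₀ ∷ zipWith (λ {P} → sum∉ {P}) (x∉Ps , zs)
        where
        -- x ∈ P₀ and z ∉ P₀.
        sum∉P₀ : ¬ mem P₀ (x + z)
        sum∉P₀ x+z∈P₀ = z∉P₀ (ideal-cancelˡ P₀ x+z∈P₀ x∈P₀)
        -- If P ⊆ P₀ then x + z ∉ P as x + z ∉ P₀; if z ∈ P then x + z ∉ P as x ∉ P.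
        sum∉ : ∀ {P} → ¬ mem P x × (_⊆ₛ_ R (mem P) (mem P₀) ⊎ mem P z) → ¬ mem P (x + z)
        sum∉ (_ , inj₁ P⊆P₀) x+z∈P = sum∉P₀ (P⊆P₀ _ x+z∈P)
        sum∉ {P} (x∉P , inj₂ z∈P) x+z∈P = x∉P (ideal-cancelʳ P x+z∈P z∈P)

      avoid-radicals : IsMaximal R M → (Qs : List (Ideal R)) → All (IsPrimary R) Qs →
                       ¬ InAss R Qs M → Σ Carrier λ x → mem M x × All (λ Q → ¬ radMem R Q x) Qs
      avoid-radicals M-max Qs primaries M∉Ass
        with prime-avoidance (map radical Qs)
               (AllP.map⁺ (mapAll (λ {Q} → radical-prime {Q}) primaries))
               (AllP.map⁺ (zipWith (λ {Q} (primQ , rQ≠M) → maximal-not-below-radical {Q} {M} primQ M-max rQ≠M)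
                                   (primaries , AllP.¬Any⇒All¬ Qs M∉Ass)))
      ... | x , x∈M , x∉rQs = x , x∈M , AllP.map⁻ x∉rQs

mainTheorem11 : {c ℓ : Level} → ExcludedMiddle (suc (c ⊔ ℓ)) →
    (R : CommutativeRing c ℓ) → (I J : Ideal R) →
    NonTrivial R I → NonTrivial R J →
    (Qs Q's : List (Ideal R)) →
    IsPrimaryDecomposition R I Qs → IsPrimaryDecomposition R J Q's →
    ¬ (∀ (M : Ideal R) → IsMaximal R M → InAss R Qs M ⊎ InAss R Q's M) →
    DistLe2 R I J
mainTheorem11 em R I J (_ , I≠R) (_ , J≠R) Qs Q's decI decJ uncovered
  with ¬∀⇒∃¬ R em uncovered
... | M , M-max , M∉Ass
  with avoid-radicals R em M M-max (Qs ++ Q's) (AllP.++⁺ (proj₁ decI) (proj₁ decJ))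
         (M∉Ass ∘ AnyP.++⁻ Qs)
... | x , x∈M , x∉rQs++rQ's with AllP.++⁻ Qs x∉rQs++rQ's
... | x∉rQs , x∉rQ's =
  inj₂ (inj₂ (principal R x ,
              principal-nontrivial R I M (regular-∉ R I I≠R regI) x∈M (proj₁ M-max) ,
              adjacent-principal R I I≠R regI ,
              adjacent-sym R J (principal R x) (adjacent-principal R J J≠R regJ)))
  where
  regI : Regular R I x
  regI = regular-decomposition R I Qs decI x∉rQs
  regJ : Regular R J x
  regJ = regular-decomposition R J Q's decJ x∉rQ's
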